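{- Let $n\ge 7$ and let $\mathcal{F}$ be a left-shifted independent set of $\Gamma(n,1,n-3)$. Let $\mathcal{F}_2$ be the set of flags $(A,B)\in\mathcal{F}$ with $1\notin B$. If $|\mathcal{F}_2|>n-3$, then $\mathcal{F}_2$ contains two flags $(A_1,B_1),(A_2,B_2)$ with $B_1\neq B_2$, $n\notin B_1\cup B_2$ and $A_1=A_2=\{2\}$.
   Context: $[n]=\{1,\dots,n\}$. The graph $\Gamma(n,1,n-3)$ has as vertices the pairs (flags) $(A,B)$ with $A\subseteq B\subseteq[n]$, $|A|=1$, $|B|=n-3$; two vertices $(A_1,B_1),(A_2,B_2)$ are adjacent (opposite) iff $B_1\cup B_2=[n]$, $A_1\cap B_2=\emptyset$ and $A_2\cap B_1=\emptyset$. An independent set is a set of pairwise non-adjacent vertices. For $X\subseteq[n]$, $S_{i,j}(X)=(X\setminus\{i\})\cup\{j\}$ if $i\in X$, $j\notin X$, and $S_{i,j}(X)=X$ otherwise; $S_{i,j}((A,B))=(S_{i,j}(A),S_{i,j}(B))$. For a set $\mathcal{F}$ of flags, $S_{i,j}(\mathcal{F})$ is obtained by replacing each $f\in\mathcal{F}$ by $S_{i,j}(f)$ whenever $S_{i,j}(f)\notin\mathcal{F}$ (and keeping $f$ otherwise). $\mathcal{F}$ is left-shifted if $S_{i,j}(\mathcal{F})=\mathcal{F}$ for all $i\ge j$; equivalently, $S_{i,j}(f)\in\mathcal{F}$ for all $f\in\mathcal{F}$ and all $i\ge j$. -}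

module Defs where

open import Data.Nat using (ℕ; _∸_) renaming (suc to 1+)
open import Data.Bool using (Bool; true; false; _∧_; not; if_then_else_)
open import Data.Fin using (Fin; zero; suc)
open import Data.Fin.Subset using (Subset; _∈_; _∉_; _⊆_; _∪_; _∩_; ⊤; ⊥; ∣_∣; inside; outside)
open import Data.Fin.Subset.Properties using (_∈?_)
open import Data.Vec using (lookup; _[_]≔_)
open import Data.Product using (_×_; _,_; proj₁; proj₂)
open import Data.List using (List; filter)
open import Relation.Binary.PropositionalEquality using (_≡_)
open import Relation.Nullary using (¬_)
open import Relation.Nullary.Decidable using (¬?)

-- Points of [n] = {1,…,n} are represented by Fin n: the point k is the
-- element of Fin n with toℕ equal to k - 1.

Pair : ℕ → Set
Pair n = Subset n × Subset n

IsFlag : (n : ℕ) → Pair n → Set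
IsFlag n (A , B) = (A ⊆ B) × (∣ A ∣ ≡ 1) × (∣ B ∣ ≡ n ∸ 3)

Opposite : {n : ℕ} → Pair n → Pair n → Set
Opposite (A₁ , B₁) (A₂ , B₂) = (B₁ ∪ B₂ ≡ ⊤) × (A₁ ∩ B₂ ≡ ⊥) × (A₂ ∩ B₁ ≡ ⊥)

shift : {n : ℕ} → Fin n → Fin n → Subset n → Subset n
shift i j X =
  if lookup X i ∧ not (lookup X j)
  then ((X [ i ]≔ outside) [ j ]≔ inside)
  else X

shiftPair : {n : ℕ} → Fin n → Fin n → Pair n → Pair n
shiftPair i j (A , B) = (shift i j A , shift i j B)

open import Data.List.Membership.Propositional using () renaming (_∈_ to _∈ₗ_)
open import Data.List.Relation.Unary.Unique.Propositional using (Unique)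
import Data.Fin as F

IsFlagFamily : (n : ℕ) → List (Pair n) → Set
IsFlagFamily n 𝓕 = Unique 𝓕 × (∀ {f} → f ∈ₗ 𝓕 → IsFlag n f)

Independent : {n : ℕ} → List (Pair n) → Set
Independent 𝓕 = ∀ {f g} → f ∈ₗ 𝓕 → g ∈ₗ 𝓕 → ¬ Opposite f g

LeftShifted : {n : ℕ} → List (Pair n) → Set
LeftShifted 𝓕 = ∀ {f} (i j : Fin _) → j F.≤ i → f ∈ₗ 𝓕 → shiftPair i j f ∈ₗ 𝓕

𝓕₂ : {m : ℕ} → List (Pair (1+ m)) → List (Pair (1+ m))
𝓕₂ = filter (λ f → ¬? (zero ∈? proj₂ f))

module Submission where

-- Left-shiftedness lets a flag (A , B) of 𝓕 be pushed, one shift at a time and without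
-- leaving 𝓕, to a flag (A′ , C) whenever every point of B ∖ C lies above every point of
-- C ∖ B; shifting the point of A′ down to the least point of C then gives (⁅ min C ⁆ , C).
-- Hence every flag of 𝓕₂ yields ({2} , [n] ∖ {1, n−1, n}) ∈ 𝓕₂. Distinct flags with the
-- same B have distinct points A ⊆ B, so more than n − 3 flags in 𝓕₂ force one whose B is
-- not [n] ∖ {1, n−1, n}; such a B contains n − 1 after at most one shift n → n − 1, and is
-- then pushed to [n] ∖ {1, n−2, n}.

open import Defs
open import Data.Nat using (ℕ; _+_; _∸_; _>_)
open import Data.Fin using (Fin; zero; suc; fromℕ)
open import Data.Fin.Subset using (Subset; _∉_; _∪_; ⁅_⁆)
open import Data.List using (List; length)
open import Data.List.Membership.Propositional using (_∈_)
open import Data.Product using (Σ; _×_; _,_)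
open import Relation.Binary.PropositionalEquality using (_≢_)

open import Data.Bool using (true; false) renaming (_≟_ to _≟ᵇ_)
open import Data.Fin using (toℕ; inject₁; _≤_; _<_; _≟_)
open import Data.Fin.Properties using (≤∧≢⇒<; <⇒≢; <-trans; ≤fromℕ; toℕ-fromℕ; toℕ-inject₁)
open import Data.Fin.Subset
  using (inside; outside; ⊤; _∩_; ∁; _-_; Empty; ∣_∣)
  renaming (_∈_ to _∈ₛ_; _⊆_ to _⊆ₛ_; _⊂_ to _⊂ₛ_)
open import Data.Fin.Subset.Properties
open import Data.List using ([]; _∷_)
open import Data.List.Membership.Propositional using (find)
open import Data.List.Membership.Propositional.Properties using (∈-filter⁺; ∈-filter⁻)
open import Data.List.Relation.Unary.All as All using (All; []; _∷_; all?)
open import Data.List.Relation.Unary.All.Properties using (¬All⇒Any¬)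
open import Data.List.Relation.Unary.AllPairs using ([]; _∷_)
open import Data.List.Relation.Unary.Unique.Propositional using (Unique)
import Data.List.Relation.Unary.Unique.Propositional.Properties as Unique
import Data.Nat as ℕ
import Data.Nat.Properties as ℕ
open import Data.Nat.Induction using (<-wellFounded)
open import Data.Product using (∃; proj₁; proj₂; map₂)
open import Data.Sum using (_⊎_; inj₁; inj₂; [_,_]′)
open import Data.Vec using (_∷_; here; there; lookup; _[_]≔_)
open import Data.Vec.Properties using ([]=⇒lookup; lookup⇒[]=; []≔-updates; lookup∘update′; ≡-dec)
open import Function using (_∘_)
open import Induction.WellFounded using (Acc; acc)
open import Relation.Binary.PropositionalEquality
  using (_≡_; refl; sym; trans; cong; cong₂; subst; subst₂; module ≡-Reasoning)
open import Relation.Nullary using (yes; no; contradiction)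
open import Relation.Nullary.Decidable using (¬?)
open import Relation.Unary using (Decidable)

private variable
  n : ℕ
  p q : Subset n
  b x y i j : Fin n

x∈p∩∁q⁺ : x ∈ₛ p → x ∉ q → x ∈ₛ p ∩ ∁ q
x∈p∩∁q⁺ x∈p x∉q = x∈p∩q⁺ (x∈p , x∉p⇒x∈∁p x∉q)

x∈p∩∁q⁻ : ∀ (p q : Subset n) → x ∈ₛ p ∩ ∁ q → x ∈ₛ p × x ∉ q
x∈p∩∁q⁻ p q = map₂ x∈∁p⇒x∉p ∘ x∈p∩q⁻ p (∁ q)

∩∁-Empty⇒⊆ : Empty (p ∩ ∁ q) → p ⊆ₛ q
∩∁-Empty⇒⊆ {q = q} empty {x} x∈p with x ∈? q
... | yes x∈q = x∈q
... | no  x∉q = contradiction (x , x∈p∩∁q⁺ x∈p x∉q) empty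

⊆∧∣∣≡⇒≡ : p ⊆ₛ q → ∣ p ∣ ≡ ∣ q ∣ → p ≡ q
⊆∧∣∣≡⇒≡ {p = p} {q = q} p⊆q ∣p∣≡∣q∣ with nonempty? (q ∩ ∁ p)
... | no  empty         = ⊆-antisym p⊆q (∩∁-Empty⇒⊆ empty)
... | yes (x , x∈q∖p) = contradiction ∣p∣≡∣q∣ (ℕ.<⇒≢ (p⊂q⇒∣p∣<∣q∣ (p⊆q , x , x∈q∩∁p⁻ x∈q∖p)))
  where x∈q∩∁p⁻ = x∈p∩∁q⁻ q p

x∈p∧∣p∣≡1⇒p≡⁅x⁆ : x ∈ₛ p → ∣ p ∣ ≡ 1 → p ≡ ⁅ x ⁆
x∈p∧∣p∣≡1⇒p≡⁅x⁆ {x = x} {p = p} x∈p ∣p∣≡1 =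
  sym (⊆∧∣∣≡⇒≡ ⁅x⁆⊆p (trans (∣⁅x⁆∣≡1 x) (sym ∣p∣≡1)))
  where
  ⁅x⁆⊆p : ⁅ x ⁆ ⊆ₛ p
  ⁅x⁆⊆p y∈⁅x⁆ = subst (_∈ₛ p) (sym (x∈⁅y⁆⇒x≡y x y∈⁅x⁆)) x∈p

∣p∣≡1⇒p≡⁅x⁆ : {p : Subset n} → ∣ p ∣ ≡ 1 → ∃ λ x → p ≡ ⁅ x ⁆
∣p∣≡1⇒p≡⁅x⁆ {n = n} {p = p} ∣p∣≡1 with nonempty? p
... | yes (x , x∈p) = x , x∈p∧∣p∣≡1⇒p≡⁅x⁆ x∈p ∣p∣≡1
... | no  empty with trans (sym ∣p∣≡1) (trans (cong ∣_∣ (Empty-unique empty)) (∣⊥∣≡0 n))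
...   | ()

x∉p-x : x ∉ p - x
x∉p-x {x = suc x} {p = _ ∷ p} (there x∈p-x) = x∉p-x x∈p-x

x∈p-y⇒x≢y : x ∈ₛ p - y → x ≢ y
x∈p-y⇒x≢y x∈p-x refl = x∉p-x x∈p-x

x∈p⇒suc∣p-x∣≡∣p∣ : x ∈ₛ p → ℕ.suc ∣ p - x ∣ ≡ ∣ p ∣
x∈p⇒suc∣p-x∣≡∣p∣ {p = inside  ∷ p} here        = cong ℕ.suc (cong ∣_∣ (p─⊥≡p p))
x∈p⇒suc∣p-x∣≡∣p∣ {p = inside  ∷ p} (there x∈p) = cong ℕ.suc (x∈p⇒suc∣p-x∣≡∣p∣ x∈p)
x∈p⇒suc∣p-x∣≡∣p∣ {p = outside ∷ p} (there x∈p) = x∈p⇒suc∣p-x∣≡∣p∣ x∈p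

≤∧≢⇒≤pred : {i k : Fin n} → toℕ i ≡ ℕ.suc (toℕ k) → j ≤ i → j ≢ i → j ≤ k
≤∧≢⇒≤pred i≡1+k j≤i j≢i = ℕ.≤-pred (subst (_ ℕ.<_) i≡1+k (≤∧≢⇒< j≤i j≢i))

module _ {X : Subset n} where

  i∉X⇒shift≡id : i ∉ X → shift i j X ≡ X
  i∉X⇒shift≡id {i = i} i∉X with lookup X i in eq
  ... | true  = contradiction (lookup⇒[]= i X eq) i∉X
  ... | false = refl

  j∈X⇒shift≡id : j ∈ₛ X → shift i j X ≡ X
  j∈X⇒shift≡id {j = j} {i = i} j∈X rewrite []=⇒lookup j∈X with lookup X i
  ... | true  = refl
  ... | false = refl

  shift-moves : i ∈ₛ X → j ∉ X → shift i j X ≡ (X [ i ]≔ outside) [ j ]≔ inside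
  shift-moves {i = i} {j = j} i∈X j∉X rewrite []=⇒lookup i∈X with lookup X j in eq
  ... | true  = contradiction (lookup⇒[]= j X eq) j∉X
  ... | false = refl

  lookup-shift : x ≢ i → x ≢ j → lookup (shift i j X) x ≡ lookup X x
  lookup-shift {x = x} {i = i} {j = j} x≢i x≢j with i ∈? X | j ∈? X
  ... | no  i∉X | _       = cong (λ Y → lookup Y x) (i∉X⇒shift≡id i∉X)
  ... | yes _   | yes j∈X = cong (λ Y → lookup Y x) (j∈X⇒shift≡id j∈X)
  ... | yes i∈X | no  j∉X = begin
    lookup (shift i j X) x                       ≡⟨ cong (λ Y → lookup Y x) (shift-moves i∈X j∉X) ⟩
    lookup ((X [ i ]≔ outside) [ j ]≔ inside) x  ≡⟨ lookup∘update′ x≢j (X [ i ]≔ outside) inside ⟩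
    lookup (X [ i ]≔ outside) x                  ≡⟨ lookup∘update′ x≢i X outside ⟩
    lookup X x                                   ∎
    where open ≡-Reasoning

  j∈shift : i ∈ₛ X → j ∈ₛ shift i j X
  j∈shift {i = i} {j = j} i∈X with j ∈? X
  ... | yes j∈X = subst (j ∈ₛ_) (sym (j∈X⇒shift≡id j∈X)) j∈X
  ... | no  j∉X = subst (j ∈ₛ_) (sym (shift-moves i∈X j∉X)) ([]≔-updates (X [ i ]≔ outside) j)

  ∈-shift⁺ : x ∈ₛ X → x ≢ i → x ∈ₛ shift i j X
  ∈-shift⁺ {x = x} {j = j} x∈X x≢i with x ≟ j
  ... | yes refl = subst (x ∈ₛ_) (sym (j∈X⇒shift≡id x∈X)) x∈X
  ... | no  x≢j  = lookup⇒[]= x _ (trans (lookup-shift x≢i x≢j) ([]=⇒lookup x∈X))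

  ∈-shift⁻ : x ∈ₛ shift i j X → x ≢ j → x ∈ₛ X
  ∈-shift⁻ {x = x} {i = i} x∈X′ x≢j with x ≟ i | i ∈? X
  ... | yes refl | yes i∈X = i∈X
  ... | yes refl | no  i∉X = subst (x ∈ₛ_) (i∉X⇒shift≡id i∉X) x∈X′
  ... | no  x≢i  | _       = lookup⇒[]= x X (trans (sym (lookup-shift x≢i x≢j)) ([]=⇒lookup x∈X′))

_⇊_ : Subset n → Subset n → Set
B ⇊ C = ∀ {i j} → i ∈ₛ B → i ∉ C → j ∈ₛ C → j ∉ B → j ≤ i

module LeftShiftedFamily {𝓕 : List (Pair n)}
  (flag : ∀ {f} → f ∈ 𝓕 → IsFlag n f) (shifted : LeftShifted 𝓕) where

  -- Shifting a point i of B ∖ C onto a point j of C ∖ B preserves B ⇊ C and removes j from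
  -- C ∖ B, so the recursion is on ∣ C ∖ B ∣.
  compress : ∀ {A B C} → ∣ C ∣ ≡ n ∸ 3 → (A , B) ∈ 𝓕 → B ⇊ C → ∃ λ A′ → (A′ , C) ∈ 𝓕
  compress {C = C} ∣C∣ = go (<-wellFounded _)
    where
    ∣B∣≡∣C∣ : ∀ {A B} → (A , B) ∈ 𝓕 → ∣ B ∣ ≡ ∣ C ∣
    ∣B∣≡∣C∣ AB∈𝓕 = trans (proj₂ (proj₂ (flag AB∈𝓕))) (sym ∣C∣)

    go : ∀ {A B} → Acc ℕ._<_ ∣ C ∩ ∁ B ∣ → (A , B) ∈ 𝓕 → B ⇊ C → ∃ λ A′ → (A′ , C) ∈ 𝓕
    go {A} {B} (acc smaller) AB∈𝓕 B⇊C with nonempty? (C ∩ ∁ B)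
    ... | no C⊆B = A , subst (λ C′ → (A , C′) ∈ 𝓕) B≡C AB∈𝓕
      where B≡C = sym (⊆∧∣∣≡⇒≡ (∩∁-Empty⇒⊆ C⊆B) (sym (∣B∣≡∣C∣ AB∈𝓕)))
    ... | yes (j , j∈C∖B) with x∈p∩∁q⁻ C B j∈C∖B | nonempty? (B ∩ ∁ C)
    ...   | j∈C , j∉B | no B⊆C =
      contradiction (subst (j ∈ₛ_) (sym (⊆∧∣∣≡⇒≡ (∩∁-Empty⇒⊆ B⊆C) (∣B∣≡∣C∣ AB∈𝓕))) j∈C) j∉B
    ...   | j∈C , j∉B | yes (i , i∈B∖C) with x∈p∩∁q⁻ B C i∈B∖C
    ...     | i∈B , i∉C =
      go (smaller (p⊂q⇒∣p∣<∣q∣ progress)) (shifted i j (B⇊C i∈B i∉C j∈C j∉B) AB∈𝓕) B′⇊C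
      where
      B′ = shift i j B

      still-missing : ∀ {x} → x ∈ₛ C → x ∉ B′ → x ∉ B
      still-missing x∈C x∉B′ x∈B = x∉B′ (∈-shift⁺ x∈B λ { refl → i∉C x∈C })

      progress : C ∩ ∁ B′ ⊂ₛ C ∩ ∁ B
      progress =
        (λ x∈C∖B′ → let x∈C , x∉B′ = x∈p∩∁q⁻ C B′ x∈C∖B′ in
                      x∈p∩∁q⁺ x∈C (still-missing x∈C x∉B′)) ,
        j , j∈C∖B , λ j∈C∖B′ → proj₂ (x∈p∩∁q⁻ C B′ j∈C∖B′) (j∈shift i∈B)

      B′⇊C : B′ ⇊ C
      B′⇊C i′∈B′ i′∉C j′∈C j′∉B′ =
        B⇊C (∈-shift⁻ i′∈B′ λ { refl → i′∉C j∈C }) i′∉C j′∈C (still-missing j′∈C j′∉B′)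

  move-to-least : ∀ {A C j} → (A , C) ∈ 𝓕 → j ∈ₛ C → (∀ {a} → a ∈ₛ C → j ≤ a) → (⁅ j ⁆ , C) ∈ 𝓕
  move-to-least {A} {C} {j} AC∈𝓕 j∈C least with ∣p∣≡1⇒p≡⁅x⁆ {p = A} (proj₁ (proj₂ (flag AC∈𝓕)))
  ... | a , refl = subst₂ (λ A′ C′ → (A′ , C′) ∈ 𝓕) A′≡⁅j⁆ (j∈X⇒shift≡id j∈C) shifted∈𝓕
    where
    shifted∈𝓕 = shifted a j (least (proj₁ (flag AC∈𝓕) (x∈⁅x⁆ a))) AC∈𝓕
    A′≡⁅j⁆ = x∈p∧∣p∣≡1⇒p≡⁅x⁆ (j∈shift (x∈⁅x⁆ a)) (proj₁ (proj₂ (flag shifted∈𝓕)))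

length≤∣D∣ : ∀ {B D : Subset n} {L : List (Pair n)} → Unique L →
  All (λ f → proj₂ f ≡ B × ∣ proj₁ f ∣ ≡ 1 × proj₁ f ⊆ₛ D) L → length L ℕ.≤ ∣ D ∣
length≤∣D∣ [] [] = ℕ.z≤n
length≤∣D∣ {B = B} {D} {(A , _) ∷ L} (fresh ∷ unique) ((refl , ∣A∣≡1 , A⊆D) ∷ rest)
  with ∣p∣≡1⇒p≡⁅x⁆ {p = A} ∣A∣≡1
... | a , refl = ℕ.≤-trans (ℕ.s≤s (length≤∣D∣ unique (All.zipWith shrink (fresh , rest))))
                           (x∈p⇒∣p-x∣<∣p∣ (A⊆D (x∈⁅x⁆ a)))
  where
  shrink : ∀ {f} → (⁅ a ⁆ , B) ≢ f × (proj₂ f ≡ B × ∣ proj₁ f ∣ ≡ 1 × proj₁ f ⊆ₛ D) →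
           proj₂ f ≡ B × ∣ proj₁ f ∣ ≡ 1 × proj₁ f ⊆ₛ D - a
  shrink (distinct , B′≡B , ∣A′∣≡1 , A′⊆D) = B′≡B , ∣A′∣≡1 , λ x∈A′ →
    x∈p∧x≢y⇒x∈p-y (A′⊆D x∈A′) λ { refl →
      distinct (cong₂ _,_ (sym (x∈p∧∣p∣≡1⇒p≡⁅x⁆ x∈A′ ∣A′∣≡1)) (sym B′≡B)) }

-- top, t₁, t₂ are the points n, n − 1, n − 2 of [n], where n = 5 + m, and allBut b is
-- [n] ∖ {1, b, n}.
module Points (m : ℕ) where

  top t₁ t₂ : Fin (5 + m)
  top = fromℕ (4 + m)
  t₁  = inject₁ (fromℕ (3 + m))
  t₂  = inject₁ (inject₁ (fromℕ (2 + m)))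

  toℕ-top : toℕ top ≡ ℕ.suc (toℕ t₁)
  toℕ-top = trans (toℕ-fromℕ (4 + m)) (cong ℕ.suc (sym (trans (toℕ-inject₁ _) (toℕ-fromℕ (3 + m)))))

  toℕ-t₁ : toℕ t₁ ≡ ℕ.suc (toℕ t₂)
  toℕ-t₁ = trans (trans (toℕ-inject₁ _) (toℕ-fromℕ (3 + m)))
                 (cong ℕ.suc (sym (trans (toℕ-inject₁ _) (trans (toℕ-inject₁ _) (toℕ-fromℕ (2 + m))))))

  t₁<top : t₁ < top
  t₁<top = ℕ.≤-reflexive (sym toℕ-top)

  t₂<t₁ : t₂ < t₁
  t₂<t₁ = ℕ.≤-reflexive (sym toℕ-t₁)

  allBut : Fin (5 + m) → Subset (5 + m)
  allBut b = ⊤ - zero - b - top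

  ∈allBut : ∀ b → x ≢ zero → x ≢ b → x ≢ top → x ∈ₛ allBut b
  ∈allBut b x≢0 x≢b x≢top = x∈p∧x≢y⇒x∈p-y (x∈p∧x≢y⇒x∈p-y (x∈p∧x≢y⇒x∈p-y ∈⊤ x≢0) x≢b) x≢top

  ∈allBut⁻ : ∀ b → x ∈ₛ allBut b → x ≢ zero × x ≢ b × x ≢ top
  ∈allBut⁻ b x∈ =
    x∈p-y⇒x≢y {p = ⊤} (p─q⊆p _ ⁅ b ⁆ (p─q⊆p _ ⁅ top ⁆ x∈)) ,
    x∈p-y⇒x≢y {p = ⊤ - zero} (p─q⊆p _ ⁅ top ⁆ x∈) ,
    x∈p-y⇒x≢y {p = ⊤ - zero - b} x∈

  ∉allBut : ∀ b → x ∉ allBut b → x ≡ zero ⊎ x ≡ b ⊎ x ≡ top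
  ∉allBut {x = x} b x∉ with x ≟ zero | x ≟ b | x ≟ top
  ... | yes x≡0 | _       | _         = inj₁ x≡0
  ... | no  _   | yes x≡b | _         = inj₂ (inj₁ x≡b)
  ... | no  _   | no  _   | yes x≡top = inj₂ (inj₂ x≡top)
  ... | no  x≢0 | no  x≢b | no  x≢top = contradiction (∈allBut b x≢0 x≢b x≢top) x∉

  ∣allBut∣ : ∀ b → b ≢ zero → b ≢ top → ∣ allBut b ∣ ≡ (5 + m) ∸ 3
  ∣allBut∣ b b≢0 b≢top = begin
    ∣ ⊤ - zero - b - top ∣                  ≡⟨ drop (⊤ - zero - b) top top∈ ⟩
    ℕ.pred ∣ ⊤ - zero - b ∣                 ≡⟨ cong ℕ.pred (drop (⊤ - zero) b (x∈p∧x≢y⇒x∈p-y ∈⊤ b≢0)) ⟩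
    ℕ.pred (ℕ.pred ∣ ⊤ {5 + m} - zero ∣)    ≡⟨ cong (ℕ.pred ∘ ℕ.pred) (drop ⊤ zero ∈⊤) ⟩
    ℕ.pred (ℕ.pred (ℕ.pred ∣ ⊤ {5 + m} ∣))  ≡⟨ cong (ℕ.pred ∘ ℕ.pred ∘ ℕ.pred) (∣⊤∣≡n (5 + m)) ⟩
    (5 + m) ∸ 3                             ∎
    where
    open ≡-Reasoning
    drop : ∀ p x → x ∈ₛ p → ∣ p - x ∣ ≡ ℕ.pred ∣ p ∣
    drop _ _ x∈p = cong ℕ.pred (x∈p⇒suc∣p-x∣≡∣p∣ x∈p)
    top∈ : top ∈ₛ ⊤ - zero - b
    top∈ = x∈p∧x≢y⇒x∈p-y (x∈p∧x≢y⇒x∈p-y {y = zero} ∈⊤ (λ ())) (b≢top ∘ sym)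

zero∉? : Decidable λ (f : Pair (ℕ.suc n)) → zero ∉ proj₂ f
zero∉? f = ¬? (zero ∈? proj₂ f)

module Reach {m : ℕ} {𝓕 : List (Pair (5 + m))}
  (flag : ∀ {f} → f ∈ 𝓕 → IsFlag (5 + m) f) (shifted : LeftShifted 𝓕) where

  open Points m
  open LeftShiftedFamily flag shifted

  ⁅2⁆,allBut∈𝓕 : ∀ {A B} b → b ≢ zero → b ≢ top → suc zero ≢ b → (A , B) ∈ 𝓕 → zero ∉ B →
    (∀ {j} → j ∈ₛ allBut b → j ∉ B → j ≤ b) → (⁅ suc zero ⁆ , allBut b) ∈ 𝓕
  ⁅2⁆,allBut∈𝓕 {B = B} b b≢0 b≢top 2≢b AB∈𝓕 0∉B below =
    move-to-least (proj₂ (compress (∣allBut∣ b b≢0 b≢top) AB∈𝓕 B⇊allBut))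
                  (∈allBut b (λ ()) 2≢b (λ ())) 1≤toℕ
    where
    B⇊allBut : B ⇊ allBut b
    B⇊allBut i∈B i∉ j∈ j∉B with ∉allBut b i∉
    ... | inj₁ refl        = contradiction i∈B 0∉B
    ... | inj₂ (inj₁ refl) = below j∈ j∉B
    ... | inj₂ (inj₂ refl) = ≤fromℕ _

    1≤toℕ : ∀ {a} → a ∈ₛ allBut b → 1 ℕ.≤ toℕ a
    1≤toℕ {zero}  a∈ = contradiction refl (proj₁ (∈allBut⁻ b a∈))
    1≤toℕ {suc _} _  = ℕ.s≤s ℕ.z≤n

  ⁅2⁆,allBut-t₁∈𝓕 : ∀ {A B} → (A , B) ∈ 𝓕 → zero ∉ B → (⁅ suc zero ⁆ , allBut t₁) ∈ 𝓕
  ⁅2⁆,allBut-t₁∈𝓕 AB∈𝓕 0∉B = ⁅2⁆,allBut∈𝓕 t₁ (λ ()) (<⇒≢ t₁<top) (λ ()) AB∈𝓕 0∉B λ j∈ _ →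
    ≤∧≢⇒≤pred toℕ-top (≤fromℕ _) (proj₂ (proj₂ (∈allBut⁻ t₁ j∈)))

  ⁅2⁆,allBut-t₂∈𝓕-from-t₁∈ : ∀ {A B} → (A , B) ∈ 𝓕 → zero ∉ B → t₁ ∈ₛ B →
    (⁅ suc zero ⁆ , allBut t₂) ∈ 𝓕
  ⁅2⁆,allBut-t₂∈𝓕-from-t₁∈ AB∈𝓕 0∉B t₁∈B =
    ⁅2⁆,allBut∈𝓕 t₂ (λ ()) (<⇒≢ (<-trans t₂<t₁ t₁<top)) (λ ()) AB∈𝓕 0∉B λ j∈ j∉B →
      ≤∧≢⇒≤pred toℕ-t₁ (≤∧≢⇒≤pred toℕ-top (≤fromℕ _) (proj₂ (proj₂ (∈allBut⁻ t₂ j∈))))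
        λ { refl → j∉B t₁∈B }

  ⁅2⁆,allBut-t₂∈𝓕 : ∀ {A B} → (A , B) ∈ 𝓕 → zero ∉ B → B ≢ allBut t₁ →
    (⁅ suc zero ⁆ , allBut t₂) ∈ 𝓕
  ⁅2⁆,allBut-t₂∈𝓕 {B = B} AB∈𝓕 0∉B B≢allBut-t₁ with t₁ ∈? B | top ∈? B
  ... | yes t₁∈B | _         = ⁅2⁆,allBut-t₂∈𝓕-from-t₁∈ AB∈𝓕 0∉B t₁∈B
  ... | no  _    | yes top∈B = ⁅2⁆,allBut-t₂∈𝓕-from-t₁∈ (shifted top t₁ (≤fromℕ t₁) AB∈𝓕)
                                 (λ 0∈B′ → 0∉B (∈-shift⁻ 0∈B′ (λ ()))) (j∈shift top∈B)
  ... | no  t₁∉B | no  top∉B = contradiction (⊆∧∣∣≡⇒≡ B⊆allBut-t₁ ∣B∣≡) B≢allBut-t₁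
    where
    B⊆allBut-t₁ : B ⊆ₛ allBut t₁
    B⊆allBut-t₁ x∈B =
      ∈allBut t₁ (λ { refl → 0∉B x∈B }) (λ { refl → t₁∉B x∈B }) (λ { refl → top∉B x∈B })
    ∣B∣≡ : ∣ B ∣ ≡ ∣ allBut t₁ ∣
    ∣B∣≡ = trans (proj₂ (proj₂ (flag AB∈𝓕))) (sym (∣allBut∣ t₁ (λ ()) (<⇒≢ t₁<top)))

  at-allBut-t₁? : Decidable λ (f : Pair (5 + m)) → proj₂ f ≡ allBut t₁
  at-allBut-t₁? f = ≡-dec _≟ᵇ_ (proj₂ f) (allBut t₁)

  length-𝓕₂≤ : Unique 𝓕 → All (λ f → proj₂ f ≡ allBut t₁) (𝓕₂ 𝓕) → length (𝓕₂ 𝓕) ℕ.≤ (5 + m) ∸ 3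
  length-𝓕₂≤ unique all-at =
    subst (length (𝓕₂ 𝓕) ℕ.≤_) (∣allBut∣ t₁ (λ ()) (<⇒≢ t₁<top))
      (length≤∣D∣ (Unique.filter⁺ zero∉? unique)
        (All.zipWith bounds (all-at , All.tabulate (flag ∘ proj₁ ∘ ∈-filter⁻ zero∉?))))
    where
    bounds : ∀ {f} → proj₂ f ≡ allBut t₁ × IsFlag (5 + m) f →
             proj₂ f ≡ allBut t₁ × ∣ proj₁ f ∣ ≡ 1 × proj₁ f ⊆ₛ allBut t₁
    bounds (refl , A⊆B , ∣A∣≡1 , _) = refl , ∣A∣≡1 , A⊆B

  two-⁅2⁆-flags : Unique 𝓕 → length (𝓕₂ 𝓕) > (5 + m) ∸ 3 →
    Σ (Subset (5 + m)) λ B₁ → Σ (Subset (5 + m)) λ B₂ →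
      ((⁅ suc zero ⁆ , B₁) ∈ 𝓕₂ 𝓕) × ((⁅ suc zero ⁆ , B₂) ∈ 𝓕₂ 𝓕) ×
      (B₁ ≢ B₂) × (top ∉ B₁ ∪ B₂)
  two-⁅2⁆-flags unique longer with all? at-allBut-t₁? (𝓕₂ 𝓕)
  ... | yes all-at = contradiction (length-𝓕₂≤ unique all-at) (ℕ.<⇒≱ longer)
  ... | no ¬all-at with find (¬All⇒Any¬ at-allBut-t₁? (𝓕₂ 𝓕) ¬all-at)
  ... | (A , B) , AB∈𝓕₂ , B≢allBut-t₁ with ∈-filter⁻ zero∉? AB∈𝓕₂
  ... | AB∈𝓕 , 0∉B =
    allBut t₁ , allBut t₂ ,
    ∈𝓕₂ t₁ (⁅2⁆,allBut-t₁∈𝓕 AB∈𝓕 0∉B) , ∈𝓕₂ t₂ (⁅2⁆,allBut-t₂∈𝓕 AB∈𝓕 0∉B B≢allBut-t₁) ,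
    (λ same → proj₁ (proj₂ (∈allBut⁻ t₂ (subst (t₂ ∈ₛ_) same t₂∈allBut-t₁))) refl) ,
    λ top∈ → [ top∉allBut t₁ , top∉allBut t₂ ]′ (x∈p∪q⁻ _ _ top∈)
    where
    t₂∈allBut-t₁ : t₂ ∈ₛ allBut t₁
    t₂∈allBut-t₁ = ∈allBut t₁ (λ ()) (<⇒≢ t₂<t₁) (<⇒≢ (<-trans t₂<t₁ t₁<top))
    top∉allBut : ∀ b → top ∉ allBut b
    top∉allBut b top∈ = proj₂ (proj₂ (∈allBut⁻ b top∈)) refl
    ∈𝓕₂ : ∀ b → (⁅ suc zero ⁆ , allBut b) ∈ 𝓕 → (⁅ suc zero ⁆ , allBut b) ∈ 𝓕₂ 𝓕
    ∈𝓕₂ b f∈𝓕 = ∈-filter⁺ zero∉? f∈𝓕 λ 0∈ → proj₁ (∈allBut⁻ b 0∈) refl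

lemma5p3 : (k : ℕ) (𝓕 : List (Pair (7 + k))) →
    IsFlagFamily (7 + k) 𝓕 → Independent 𝓕 → LeftShifted 𝓕 →
    length (𝓕₂ 𝓕) > (7 + k) ∸ 3 →
    Σ (Subset (7 + k)) λ B₁ → Σ (Subset (7 + k)) λ B₂ →
      ((⁅ suc zero ⁆ , B₁) ∈ 𝓕₂ 𝓕) × ((⁅ suc zero ⁆ , B₂) ∈ 𝓕₂ 𝓕) ×
      (B₁ ≢ B₂) × (fromℕ (6 + k) ∉ B₁ ∪ B₂)
lemma5p3 k 𝓕 (unique , flag) _ shifted = Reach.two-⁅2⁆-flags flag shifted unique
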